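{- If Markov's principle holds, then every Markov sequence of rationals is Cauchy.
   Context: Work constructively; $\tilde\exists x.A$ abbreviates $\neg\forall x.\neg A$. Markov's principle: for every decidable predicate $P$ on $\mathbb N$, $\neg\neg\exists n.\,P(n)$ implies $\exists n.\,P(n)$. A classical null sequence is a decreasing sequence $(q_n)$ in $\mathbb Q_{\ge0}\cup\{\infty\}$ with $\forall\epsilon>0.\,\tilde\exists m.\,\forall n\ge m.\,q_n\le\epsilon$. A modulus of non-divergence of a rational sequence $(q_n)$ is a classical null sequence $(c_n)$ with $\forall N.\,\forall n,m\ge N.\,|q_n-q_m|\le c_N$; a modulus of convergence is a non-decreasing $M:\mathbb N\to\mathbb N$ with $\forall k.\,\forall n,m\ge M(k).\,|q_n-q_m|\le2^{ -k}$. A rational sequence is Markov if it has a modulus of non-divergence and Cauchy if it has a modulus of convergence. -}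

module Defs where

open import Data.Nat as ℕ using (ℕ; zero; suc)
open import Data.Rational using (ℚ; 0ℚ; 1ℚ; ½; _*_; _-_; ∣_∣; _≤_; _<_)
open import Data.Product using (∃; _×_)
open import Relation.Nullary using (¬_; Dec)

MarkovPrinciple : Set₁
MarkovPrinciple = (P : ℕ → Set) → (∀ n → Dec (P n)) → ¬ ¬ (∃ λ n → P n) → ∃ λ n → P n

data ℚ∞ : Set where
  fin : ℚ → ℚ∞
  ∞   : ℚ∞

infix 4 _≤∞_
data _≤∞_ : ℚ∞ → ℚ∞ → Set where
  fin≤fin : ∀ {p q} → p ≤ q → fin p ≤∞ fin q
  ≤∞-top  : ∀ {x} → x ≤∞ ∞

NonNeg∞ : ℚ∞ → Set
NonNeg∞ x = fin 0ℚ ≤∞ x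

∃~ : (ℕ → Set) → Set
∃~ A = ¬ (∀ m → ¬ A m)

record ClassicalNull (c : ℕ → ℚ∞) : Set where
  field
    nonneg     : ∀ n → NonNeg∞ (c n)
    decreasing : ∀ n m → n ℕ.≤ m → c m ≤∞ c n
    null       : ∀ ε → 0ℚ < ε → ∃~ (λ m → ∀ n → m ℕ.≤ n → c n ≤∞ fin ε)

IsModNonDiv : (ℕ → ℚ) → (ℕ → ℚ∞) → Set
IsModNonDiv q c = ClassicalNull c ×
  (∀ N n m → N ℕ.≤ n → N ℕ.≤ m → fin ∣ q n - q m ∣ ≤∞ c N)

2^-_ : ℕ → ℚ
2^- zero = 1ℚ
2^- suc k = ½ * (2^- k)

IsModConv : (ℕ → ℚ) → (ℕ → ℕ) → Set
IsModConv q M = (∀ k l → k ℕ.≤ l → M k ℕ.≤ M l) ×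
  (∀ k n m → M k ℕ.≤ n → M k ℕ.≤ m → ∣ q n - q m ∣ ≤ 2^- k)

Markov : (ℕ → ℚ) → Set
Markov q = ∃ λ c → IsModNonDiv q c

Cauchy : (ℕ → ℚ) → Set
Cauchy q = ∃ λ M → IsModConv q M

module Submission where

-- Let c be a modulus of non-divergence of q.  For each k the predicate
-- "c m ≤ 2^-k" on ℕ is decidable, and nullness of c says, classically,
-- that some m satisfies it.  Markov's principle turns this classical
-- existence into an actual witness m k, and the non-divergence bound gives
-- |q n - q n'| ≤ c (m k) ≤ 2^-k for all n, n' ≥ m k.  So k ↦ m k is a
-- modulus of convergence except that it need not be monotone; replacing it
-- by its running maximum fixes that, since the bound persists for larger
-- thresholds.

open import Defs
open import Data.Nat using (ℕ)
open import Data.Rational using (ℚ)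

open import Data.Nat as ℕ using (zero; suc; _⊔_; _≤′_; ≤′-refl; ≤′-step)
import Data.Nat.Properties as ℕP
open import Data.Rational using (0ℚ; ½; _-_; ∣_∣; _≤_; _<_; Positive)
import Data.Rational.Properties as ℚP
open import Data.Product using (∃; _,_; proj₁; proj₂)
open import Relation.Nullary using (Dec; yes; no)

2^-positive : ∀ k → Positive (2^- k)
2^-positive zero    = _
2^-positive (suc k) = ℚP.pos*pos⇒pos ½ (2^- k) {{2^-positive k}}

0<2^- : ∀ k → 0ℚ < 2^- k
0<2^- k = ℚP.positive⁻¹ (2^- k) {{2^-positive k}}

-- Being below a finite rational is decidable in ℚ∪{∞}; this is what makes
-- Markov's principle applicable.
_≤∞fin?_ : ∀ x e → Dec (x ≤∞ fin e)
∞     ≤∞fin? e = no λ ()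
fin p ≤∞fin? e with p ℚP.≤? e
... | yes p≤e = yes (fin≤fin p≤e)
... | no  p≰e = no λ { (fin≤fin p≤e) → p≰e p≤e }

≤∞-trans : ∀ {x y z} → x ≤∞ y → y ≤∞ z → x ≤∞ z
≤∞-trans (fin≤fin x≤y) (fin≤fin y≤z) = fin≤fin (ℚP.≤-trans x≤y y≤z)
≤∞-trans _             ≤∞-top        = ≤∞-top

markov-∃~ : MarkovPrinciple → (P : ℕ → Set) → (∀ n → Dec (P n)) →
            ∃~ P → ∃ P
markov-∃~ mp P P? ¬∀¬P = mp P P? λ ¬∃P → ¬∀¬P λ n Pn → ¬∃P (n , Pn)

null-witness : MarkovPrinciple → ∀ {c} → ClassicalNull c →
               ∀ ε → 0ℚ < ε → ∃ λ m → c m ≤∞ fin ε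
null-witness mp {c} cn ε 0<ε =
  markov-∃~ mp (λ m → c m ≤∞ fin ε) (λ m → c m ≤∞fin? ε)
    λ noWitness → ClassicalNull.null cn ε 0<ε
      λ m tail≤ε → noWitness m (tail≤ε m ℕP.≤-refl)

nonDiv-bound : ∀ {q c} → IsModNonDiv q c → ∀ {N ε} → c N ≤∞ fin ε →
               ∀ n m → N ℕ.≤ n → N ℕ.≤ m → ∣ q n - q m ∣ ≤ ε
nonDiv-bound (_ , bound) cN≤ε n m N≤n N≤m
  with ≤∞-trans (bound _ n m N≤n N≤m) cN≤ε
... | fin≤fin diff≤ε = diff≤ε

runningMax : (ℕ → ℕ) → ℕ → ℕ
runningMax f zero    = f zero
runningMax f (suc k) = runningMax f k ⊔ f (suc k)

runningMax-mono : ∀ f {k l} → k ℕ.≤ l → runningMax f k ℕ.≤ runningMax f l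
runningMax-mono f k≤l = go (ℕP.≤⇒≤′ k≤l)
  where
  go : ∀ {k l} → k ≤′ l → runningMax f k ℕ.≤ runningMax f l
  go ≤′-refl              = ℕP.≤-refl
  go (≤′-step {l} k≤′l) = ℕP.≤-trans (go k≤′l) (ℕP.m≤m⊔n (runningMax f l) (f (suc l)))

f≤runningMax : ∀ f k → f k ℕ.≤ runningMax f k
f≤runningMax f zero    = ℕP.≤-refl
f≤runningMax f (suc k) = ℕP.m≤n⊔m (runningMax f k) (f (suc k))

monotone-modulus : ∀ q (f : ℕ → ℕ) →
  (∀ k n m → f k ℕ.≤ n → f k ℕ.≤ m → ∣ q n - q m ∣ ≤ 2^- k) → Cauchy q
monotone-modulus q f conv =
  runningMax f ,
  (λ k l → runningMax-mono f) ,
  λ k n m M≤n M≤m → conv k n m (ℕP.≤-trans (f≤runningMax f k) M≤n)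
                               (ℕP.≤-trans (f≤runningMax f k) M≤m)

lemma6p7 : MarkovPrinciple → (q : ℕ → ℚ) → Markov q → Cauchy q
lemma6p7 mp q (c , modNonDiv@(cn , _)) = monotone-modulus q threshold conv
  where
  witness : ∀ k → ∃ λ m → c m ≤∞ fin (2^- k)
  witness k = null-witness mp cn (2^- k) (0<2^- k)

  threshold : ℕ → ℕ
  threshold k = proj₁ (witness k)

  conv : ∀ k n m → threshold k ℕ.≤ n → threshold k ℕ.≤ m → ∣ q n - q m ∣ ≤ 2^- k
  conv k = nonDiv-bound {q} modNonDiv (proj₂ (witness k))
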